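{- Assume univalence and propositional truncation. If $X$ is a 1-type, then $$\prod_{Z:B\mathsf{Aut}(X)}(\mathsf{refl}_Z=\mathsf{refl}_Z)\;\simeq\;\sum_{f:\prod_{x:X}(x=x)}\prod_{g:X\simeq X}\prod_{x:X}\big(\mathsf{ap}_g(f(x))=f(g(x))\big).$$
   Context: We work in intensional Martin-Löf type theory with univalent universes and propositional truncation $\|{ - }\|$. $B\mathsf{Aut}(X):=\sum_{Z:\mathsf{Type}}\|Z=X\|$. An element $Z$ is identified with its underlying type, and $\mathsf{refl}_Z$ is the reflexivity path of that type. A 1-type is a type all of whose identity types are sets, where a set is a type any two of whose parallel paths are equal. $\mathsf{ap}_g$ is the action of $g$ on paths. -}

{-# OPTIONS --without-K #-}
module Defs where

open import Level using (Level; _⊔_; suc; Setω)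
open import Data.Product using (Σ; Σ-syntax; _,_; proj₁; proj₂)
open import Relation.Binary.PropositionalEquality using (_≡_; refl; cong)

private
  variable
    ℓ ℓ' ℓ'' : Level

isContr : Set ℓ → Set ℓ
isContr A = Σ A (λ a → (b : A) → a ≡ b)

fiber : {A : Set ℓ} {B : Set ℓ'} → (A → B) → B → Set (ℓ ⊔ ℓ')
fiber {A = A} f b = Σ A (λ a → f a ≡ b)

isEquiv : {A : Set ℓ} {B : Set ℓ'} → (A → B) → Set (ℓ ⊔ ℓ')
isEquiv {B = B} f = (b : B) → isContr (fiber f b)

infix 4 _≃_
_≃_ : Set ℓ → Set ℓ' → Set (ℓ ⊔ ℓ')
A ≃ B = Σ (A → B) isEquiv

eqv-fun : {A : Set ℓ} {B : Set ℓ'} → A ≃ B → A → B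
eqv-fun e = proj₁ e

isProp : Set ℓ → Set ℓ
isProp A = (a b : A) → a ≡ b

isSet : Set ℓ → Set ℓ
isSet A = (a b : A) (p q : a ≡ b) → p ≡ q

is1Type : Set ℓ → Set ℓ
is1Type A = (a b : A) → isSet (a ≡ b)

idToEqv : {A B : Set ℓ} → A ≡ B → A ≃ B
idToEqv {A = A} refl = (λ a → a) , λ b → (b , refl) , λ { (a , refl) → refl }

Univalence : Setω
Univalence = ∀ {ℓ} (A B : Set ℓ) → isEquiv (idToEqv {A = A} {B = B})

record PropTrunc : Setω where
  field
    ∥_∥     : ∀ {ℓ} → Set ℓ → Set ℓ
    ∣_∣     : ∀ {ℓ} {A : Set ℓ} → A → ∥ A ∥
    ∥∥-prop : ∀ {ℓ} {A : Set ℓ} → isProp ∥ A ∥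
    ∥∥-rec  : ∀ {ℓ ℓ'} {A : Set ℓ} {P : Set ℓ'} → isProp P → (A → P) → ∥ A ∥ → P

BAut : PropTrunc → Set ℓ → Set (suc ℓ)
BAut {ℓ} pt X = Σ (Set ℓ) (λ Z → ∥ Z ≡ X ∥)
  where open PropTrunc pt

{-# OPTIONS --without-K #-}
module Submission where

-- After general facts about equivalences, contractibility and
-- propositions, assuming univalence we establish:
--   1. Univalence implies function extensionality, with happly invertible.
--   2. For each Z : BAut X, (refl_Z = refl_Z) ≃ (Π z, z = z): apply the
--      equivalence idToEqv on paths, forget the propositional isEquiv
--      component, and use function extensionality.
--   3. Sections over the connected component of x of a family R with R x a
--      set are the elements of R x invariant under transport along loops at x.
--   4. For R Z = Π z, z = z, transport along q : X = X is conjugation by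
--      idToEqv q; as every self-equivalence comes from a loop (univalence),
--      invariance is exactly commutation with all g : X ≃ X.

open import Defs
open import Level using (Level; Lift; lift; lower)
open import Data.Product using (Σ; _,_; proj₁; proj₂)
open import Function.Base using (id; _∘_)
open import Function.Bundles using (_↔_; Inverse; mk↔ₛ′; _⇔_; mk⇔; Equivalence)
open import Function.Properties.Inverse using (↔-trans)
import Function.Properties.Inverse.HalfAdjointEquivalence as HalfAdjoint
open import Relation.Binary.PropositionalEquality
  using (_≡_; refl; cong; cong₂; sym; trans; subst; trans-reflʳ; trans-symˡ; trans-assoc;
         trans-cong; sym-cong; cong-∘; cong-id; naturality; module ≡-Reasoning)
open import Axiom.UniquenessOfIdentityProofs using (module Constant⇒UIP)

private
  variable
    a b c : Level
    A : Set a
    B : Set b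

-- Every inverse gives an equivalence with contractible fibres: with the
-- half-adjoint coherence, (from y , ε y) is a centre of the fibre over y.
↔⇒isEquiv : (e : A ↔ B) → isEquiv (Inverse.to e)
↔⇒isEquiv {A = A} {B = B} e y = (from y , right-inverse-of y) , contract y
  where
  open HalfAdjoint._≃_ (HalfAdjoint.↔⇒≃ e)
  fiber-path : {y : B} {x x' : A} (p : x ≡ x') (u : to x ≡ y) (u' : to x' ≡ y) →
               u ≡ trans (cong to p) u' → _≡_ {A = fiber to y} (x , u) (x' , u')
  fiber-path {x = x} refl u u' u≡u' = cong (x ,_) u≡u'
  contract : (y : B) (w : fiber to y) → (from y , right-inverse-of y) ≡ w
  contract .(to x) (x , refl) =
    fiber-path (left-inverse-of x) _ refl (sym (trans (trans-reflʳ _) (left-right x)))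

↔⇒≃ : A ↔ B → A ≃ B
↔⇒≃ e = Inverse.to e , ↔⇒isEquiv e

isEquiv⇒↔ : {f : A → B} → isEquiv f → A ↔ B
isEquiv⇒↔ {f = f} f-equiv =
  mk↔ₛ′ f (proj₁ ∘ centre) (proj₂ ∘ centre) (λ x → cong proj₁ (proj₂ (f-equiv (f x)) (x , refl)))
  where
  centre : (y : _) → fiber f y
  centre y = proj₁ (f-equiv y)

cong-↔ : (e : A ↔ B) {x x' : A} → (x ≡ x') ↔ (Inverse.to e x ≡ Inverse.to e x')
cong-↔ e {x} {x'} = mk↔ₛ′ (cong to) unwhisker section retraction
  where
  open HalfAdjoint._≃_ (HalfAdjoint.↔⇒≃ e) renaming (left-inverse-of to η; right-inverse-of to ε)
  open ≡-Reasoning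
  unwhisker : to x ≡ to x' → x ≡ x'
  unwhisker r = trans (sym (η x)) (trans (cong from r) (η x'))
  retraction : (p : x ≡ x') → unwhisker (cong to p) ≡ p
  retraction refl = trans-symˡ (η x)
  section : (r : to x ≡ to x') → cong to (unwhisker r) ≡ r
  section r = begin
    cong to (trans (sym (η x)) (trans (cong from r) (η x')))
      ≡⟨ sym (trans-cong (sym (η x))) ⟩
    trans (cong to (sym (η x))) (cong to (trans (cong from r) (η x')))
      ≡⟨ cong₂ trans (sym (sym-cong (η x))) (sym (trans-cong (cong from r))) ⟩
    trans (sym (cong to (η x))) (trans (cong to (cong from r)) (cong to (η x')))
      ≡⟨ cong₂ (λ u v → trans (sym u) (trans v (cong to (η x')))) (left-right x) (sym (cong-∘ r)) ⟩
    trans (sym (ε (to x))) (trans (cong (to ∘ from) r) (cong to (η x')))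
      ≡⟨ cong (λ v → trans (sym (ε (to x))) (trans (cong (to ∘ from) r) v)) (left-right x') ⟩
    trans (sym (ε (to x))) (trans (cong (to ∘ from) r) (ε (to x')))
      ≡⟨ cong (trans (sym (ε (to x)))) (naturality {f = to ∘ from} {g = id} ε) ⟩
    trans (sym (ε (to x))) (trans (ε (to x)) (cong id r))
      ≡⟨ sym (trans-assoc (sym (ε (to x)))) ⟩
    trans (trans (sym (ε (to x))) (ε (to x))) (cong id r)
      ≡⟨ cong (λ u → trans u (cong id r)) (trans-symˡ (ε (to x))) ⟩
    cong id r
      ≡⟨ cong-id r ⟩
    r ∎

isContr→isProp : isContr A → isProp A
isContr→isProp (c , contraction) x y = trans (sym (contraction x)) (contraction y)

singleton-isContr : (x : A) → isContr (Σ A (λ y → x ≡ y))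
singleton-isContr x = (x , refl) , λ { (y , refl) → refl }

retract-isContr : (r : A → B) (s : B → A) → (∀ y → r (s y) ≡ y) → isContr A → isContr B
retract-isContr r s rs (c , contraction) = r c , λ y → trans (cong r (contraction (s y))) (rs y)

↔-isProp : A ↔ B → isProp B → isProp A
↔-isProp e B-prop x y =
  trans (sym (strictlyInverseʳ x)) (trans (cong from (B-prop (to x) (to y))) (strictlyInverseʳ y))
  where open Inverse e

-- Hedberg's argument: a proposition gives a constant endomap on each path
-- type, hence is a set.
isProp→isSet : isProp A → isSet A
isProp→isSet A-prop x y = Constant⇒UIP.≡-irrelevant (λ {u} {v} _ → A-prop u v) (λ _ _ → refl)

Σ-prop-path : {P : A → Set b} → (∀ x → isProp (P x)) → {u v : Σ A P} → proj₁ u ≡ proj₁ v → u ≡ v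
Σ-prop-path P-prop {x , p} {.x , q} refl = cong (x ,_) (P-prop x p q)

Σ-prop-≡↔ : {P : A → Set b} → (∀ x → isProp (P x)) → {u v : Σ A P} → (u ≡ v) ↔ (proj₁ u ≡ proj₁ v)
Σ-prop-≡↔ {A = A} {P = P} P-prop = mk↔ₛ′ (cong proj₁) (Σ-prop-path P-prop) section retraction
  where
  cong-const : {C : Set c} {x : A} {p q : C} (r : p ≡ q) → cong (λ _ → x) r ≡ refl
  cong-const refl = refl
  section : {u v : Σ A P} (p : proj₁ u ≡ proj₁ v) → cong proj₁ (Σ-prop-path P-prop {u} {v} p) ≡ p
  section {x , p} {.x , q} refl = trans (sym (cong-∘ (P-prop x p q))) (cong-const (P-prop x p q))
  retraction : {u v : Σ A P} (w : u ≡ v) → Σ-prop-path P-prop (cong proj₁ w) ≡ w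
  retraction {x , p} refl = cong (cong (x ,_)) (isProp→isSet (P-prop x) p p (P-prop x p p) refl)

Σ-prop-cong-↔ : {P : A → Set b} {Q : A → Set c} → (∀ x → isProp (P x)) → (∀ x → isProp (Q x)) →
                (∀ x → P x ⇔ Q x) → Σ A P ↔ Σ A Q
Σ-prop-cong-↔ P-prop Q-prop P⇔Q = mk↔ₛ′
  (λ (x , p) → x , Equivalence.to (P⇔Q x) p)
  (λ (x , q) → x , Equivalence.from (P⇔Q x) q)
  (λ (x , q) → cong (x ,_) (Q-prop x _ q))
  (λ (x , p) → cong (x ,_) (P-prop x _ p))

identity-system-↔ : {a₀ : A} (Q : A → Set b) (q₀ : Q a₀) → isContr (Σ A Q) →
                    {a : A} → (a₀ ≡ a) ↔ Q a
identity-system-↔ {A = A} {a₀ = a₀} Q q₀ Q-contr {a} = mk↔ₛ′ (λ p → subst Q p q₀) path section retraction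
  where
  path : Q a → a₀ ≡ a
  path q = cong proj₁ (isContr→isProp Q-contr (a₀ , q₀) (a , q))
  transport-proj : {w : Σ A Q} (e : (a₀ , q₀) ≡ w) → subst Q (cong proj₁ e) q₀ ≡ proj₂ w
  transport-proj refl = refl
  section : (q : Q a) → subst Q (path q) q₀ ≡ q
  section q = transport-proj (isContr→isProp Q-contr (a₀ , q₀) (a , q))
  retraction : (p : a₀ ≡ a) → path (subst Q p q₀) ≡ p
  retraction refl = cong (cong proj₁) (trans-symˡ (proj₂ Q-contr (a₀ , q₀)))

Loops : Set a → Set a
Loops Z = (z : Z) → z ≡ z

Commutes : {X Y : Set a} → X ≃ Y → Loops X → Loops Y → Set a
Commutes {X = X} g f f' = (x : X) → cong (eqv-fun g) (f x) ≡ f' (eqv-fun g x)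

Natural : {X : Set a} → Loops X → Set a
Natural {X = X} f = (g : X ≃ X) → Commutes g f f

Invariant : (R : A → Set b) {x : A} → R x → Set _
Invariant R {x} r = (q : x ≡ x) → subst R q r ≡ r

module Univalent (ua : Univalence) where

  ua-↔ : {X Y : Set a} → (X ≡ Y) ↔ (X ≃ Y)
  ua-↔ = isEquiv⇒↔ (ua _ _)

  ≃-induction : {X Y : Set a} (P : X ≃ Y → Set b) → ((p : X ≡ Y) → P (idToEqv p)) → (e : X ≃ Y) → P e
  ≃-induction P P-paths e = subst P (Inverse.strictlyInverseˡ ua-↔ e) (P-paths (Inverse.from ua-↔ e))

  -- Post-composition with an equivalence is an equivalence; by equivalence
  -- induction it suffices to consider the identity.
  postcomp-isEquiv : {X : Set c} {Y Y' : Set a} (e : Y ≃ Y') → isEquiv (λ (h : X → Y) → eqv-fun e ∘ h)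
  postcomp-isEquiv {X = X} = ≃-induction _ (λ { refl → proj₂ (idToEqv {A = X → _} refl) })

  -- Weak function extensionality (HoTT book 4.9.4): the sections of a family
  -- of contractible types form a retract of the fibre over the identity of
  -- post-composition with the equivalence Σ X P → X.
  Π-isContr : {X : Set c} {P : X → Set b} → (∀ x → isContr (P x)) → isContr ((x : X) → P x)
  Π-isContr {b = b} {X = X} {P = P} P-contr =
    retract-isContr section-of (λ s → (λ x → x , s x) , refl) (λ _ → refl) fibre-isContr
    where
    π : Σ X P → Lift b X
    π (x , _) = lift x
    π-↔ : Σ X P ↔ Lift b X
    π-↔ = mk↔ₛ′ π (λ x → lower x , proj₁ (P-contr (lower x))) (λ _ → refl)
                (λ (x , p) → cong (x ,_) (proj₂ (P-contr x) p))
    fibre-isContr : isContr (fiber (λ (φ : X → Σ X P) → π ∘ φ) lift)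
    fibre-isContr = postcomp-isEquiv (π , ↔⇒isEquiv π-↔) lift
    section-of : fiber (λ (φ : X → Σ X P) → π ∘ φ) lift → (x : X) → P x
    section-of (φ , πφ≡lift) x = subst P (cong (λ h → lower (h x)) πφ≡lift) (proj₂ (φ x))

  -- Function extensionality, with happly an equivalence: homotopies out of f
  -- form a contractible type (a product of singletons).
  homotopy-↔ : {X : Set c} {P : X → Set b} {f g : (x : X) → P x} → (f ≡ g) ↔ ((x : X) → f x ≡ g x)
  homotopy-↔ {X = X} {P = P} {f = f} =
    identity-system-↔ (λ g → ∀ x → f x ≡ g x) (λ _ → refl)
      (retract-isContr (λ φ → proj₁ ∘ φ , proj₂ ∘ φ) (λ (g , h) x → g x , h x) (λ _ → refl)
                       (Π-isContr (λ x → singleton-isContr (f x))))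

  funext : {X : Set c} {P : X → Set b} {f g : (x : X) → P x} → ((x : X) → f x ≡ g x) → f ≡ g
  funext = Inverse.from homotopy-↔

  Π-↔ : {X : Set c} {P : X → Set a} {Q : X → Set b} → (∀ x → P x ↔ Q x) → ((x : X) → P x) ↔ ((x : X) → Q x)
  Π-↔ P↔Q = mk↔ₛ′ (λ s x → Inverse.to (P↔Q x) (s x)) (λ s x → Inverse.from (P↔Q x) (s x))
                  (λ s → funext (λ x → Inverse.strictlyInverseˡ (P↔Q x) (s x)))
                  (λ s → funext (λ x → Inverse.strictlyInverseʳ (P↔Q x) (s x)))

  isProp-Π : {X : Set c} {P : X → Set b} → (∀ x → isProp (P x)) → isProp ((x : X) → P x)
  isProp-Π P-prop f g = funext (λ x → P-prop x (f x) (g x))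

  isSet-Π : {X : Set c} {P : X → Set b} → (∀ x → isSet (P x)) → isSet ((x : X) → P x)
  isSet-Π P-set f g = ↔-isProp homotopy-↔ (isProp-Π (λ x → P-set x (f x) (g x)))

  isProp-isProp : isProp (isProp A)
  isProp-isProp A-prop A-prop' = funext (λ x → funext (λ y → isProp→isSet A-prop x y _ _))

  isProp-isContr : isProp (isContr A)
  isProp-isContr A-contr@(_ , contraction) (c' , _) =
    Σ-prop-path (λ x → isProp-Π (λ y → isProp→isSet (isContr→isProp A-contr) x y)) (contraction c')

  isProp-isEquiv : (f : A → B) → isProp (isEquiv f)
  isProp-isEquiv f = isProp-Π (λ _ → isProp-isContr)

  universe-loops-↔ : {Z : Set a} → (refl {x = Z} ≡ refl) ↔ Loops Z
  universe-loops-↔ = ↔-trans (cong-↔ ua-↔) (↔-trans (Σ-prop-≡↔ isProp-isEquiv) homotopy-↔)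

  transport-Loops-⇔ : {X Y : Set a} (q : X ≡ Y) {f : Loops X} {f' : Loops Y} →
                      (subst Loops q f ≡ f') ⇔ Commutes (idToEqv q) f f'
  transport-Loops-⇔ refl {f} =
    mk⇔ (λ f≡f' x → trans (cong-id (f x)) (Inverse.to homotopy-↔ f≡f' x))
        (λ f~f' → funext (λ x → trans (sym (cong-id (f x))) (f~f' x)))

  -- Since every self-equivalence is idToEqv of a loop, invariance under
  -- transport is naturality.
  invariant⇔natural : {X : Set a} (f : Loops X) → Invariant Loops f ⇔ Natural f
  invariant⇔natural f =
    mk⇔ (λ f-inv → ≃-induction (λ g → Commutes g f f) (λ q → Equivalence.to (transport-Loops-⇔ q) (f-inv q)))
        (λ f-nat q → Equivalence.from (transport-Loops-⇔ q) (f-nat (idToEqv q)))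

  Invariant-isProp : (R : A → Set b) {x : A} → isSet (R x) → (r : R x) → isProp (Invariant R r)
  Invariant-isProp R R-set r = isProp-Π (λ _ → R-set _ _)

  Natural-isProp : {X : Set a} → is1Type X → (f : Loops X) → isProp (Natural f)
  Natural-isProp X-1type f = isProp-Π (λ _ → isProp-Π (λ _ → X-1type _ _ _ _))

  module Components (pt : PropTrunc) where
    open PropTrunc pt

    -- The connected component of x; BAut X is the component of X in the universe.
    Component : {A : Set a} → A → Set a
    Component {A = A} x = Σ A (λ y → ∥ y ≡ x ∥)

    component-elim-↔ : {x : A} (R : A → Set b) → isSet (R x) →
                       ((y : Component x) → R (proj₁ y)) ↔ Σ (R x) (Invariant R)
    component-elim-↔ {A = A} {x = x} R R-set = mk↔ₛ′ restrict extend restrict-extend extend-restrict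
      where
      base : Component x
      base = x , ∣ refl ∣

      -- A value over y that every path x ≡ y transports r to; since R x is a
      -- set there is at most one as soon as y is merely connected to x.
      Forced : A → R x → Set _
      Forced y r = Σ (R y) (λ s → (q : x ≡ y) → subst R q r ≡ s)

      Forced-isProp : (r : R x) {y : A} → ∥ y ≡ x ∥ → isProp (Forced y r)
      Forced-isProp r = ∥∥-rec isProp-isProp (λ p → along (sym p))
        where
        along : {y : A} → x ≡ y → isProp (Forced y r)
        along refl (s , α) (s' , α') =
          Σ-prop-path (λ _ → isProp-Π (λ _ → R-set _ _)) (trans (sym (α refl)) (α' refl))

      forced : ((r , _) : Σ (R x) (Invariant R)) ((y , t) : Component x) → Forced y r
      forced (r , r-inv) (y , t) = ∥∥-rec (Forced-isProp r t) (λ p → along (sym p)) t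
        where
        along : {y : A} → x ≡ y → Forced y r
        along refl = r , r-inv

      transport-section : (F : (y : Component x) → R (proj₁ y)) {y : A} (q : x ≡ y) (t : ∥ y ≡ x ∥) →
                          subst R q (F base) ≡ F (y , t)
      transport-section F refl t = cong (λ t → F (x , t)) (∥∥-prop _ _)

      restrict : ((y : Component x) → R (proj₁ y)) → Σ (R x) (Invariant R)
      restrict F = F base , λ q → transport-section F q ∣ refl ∣

      extend : Σ (R x) (Invariant R) → (y : Component x) → R (proj₁ y)
      extend r y = proj₁ (forced r y)

      restrict-extend : (r : Σ (R x) (Invariant R)) → restrict (extend r) ≡ r
      restrict-extend r = Σ-prop-path (Invariant-isProp R R-set) (sym (proj₂ (forced r base) refl))

      extend-restrict : (F : (y : Component x) → R (proj₁ y)) → extend (restrict F) ≡ F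
      extend-restrict F = funext λ (y , t) →
        cong proj₁ (Forced-isProp (F base) t (forced (restrict F) (y , t)) (F (y , t) , λ q → transport-section F q t))

lemma8p5 : Univalence → (pt : PropTrunc) → {ℓ : Level} → (X : Set ℓ) → is1Type X →
    ((Z : BAut pt X) → refl {x = proj₁ Z} ≡ refl {x = proj₁ Z})
      ≃ Σ ((x : X) → x ≡ x)
          (λ f → (g : X ≃ X) → (x : X) → cong (eqv-fun g) (f x) ≡ f (eqv-fun g x))
lemma8p5 ua pt X X-1type = ↔⇒≃ (
  ↔-trans (Π-↔ (λ Z → universe-loops-↔))
  (↔-trans (component-elim-↔ Loops Loops-isSet)
           (Σ-prop-cong-↔ (Invariant-isProp Loops Loops-isSet) (Natural-isProp X-1type) invariant⇔natural)))
  where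
  open Univalent ua
  open Components pt
  Loops-isSet : isSet (Loops X)
  Loops-isSet = isSet-Π (λ x → X-1type x x)
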